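{- Let $m \ge 4$ be an integer and let $G = P_4 \mathbin{\Box} P_m$. Then \[ m(G,3) = \left\lfloor \frac{5(m+1)}{3} \right\rfloor + \Phi_m(G) \] for some $\Phi_m(G) \in \{1,2\}$. Moreover, $\Phi_m(G) = 1$ if $m \in \{5,7,11\}$.
   Context: For a graph $G$ and an integer $r \ge 2$, the $r$-neighbor bootstrap percolation process starting from a set $A_0 \subseteq V(G)$ of initially infected vertices is defined by $A_t = A_{t-1} \cup \{ v \in V(G) : |N_G(v) \cap A_{t-1}| \ge r\}$ for $t \ge 1$. The set $A_0$ is $r$-percolating if $\bigcup_{t \ge 0} A_t = V(G)$. The $r$-percolation number $m(G,r)$ is the minimum cardinality of an $r$-percolating set of $G$. $P_n$ denotes the path on $n$ vertices and $\mathbin{\Box}$ denotes the Cartesian product of graphs, so $P_n \mathbin{\Box} P_m$ is the $n \times m$ grid graph. -}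

module Defs where

open import Data.Nat using (ℕ; zero; suc; _≤ᵇ_; _≡ᵇ_)
open import Data.Bool using (Bool; true; false; _∧_; _∨_)
open import Data.Fin using (Fin; toℕ)
open import Data.List using (List; length; filterᵇ; cartesianProduct; allFin)
open import Data.Product using (_×_; _,_; Σ; ∃)
open import Relation.Binary.PropositionalEquality using (_≡_)
open import Data.Nat using (_≤_)

-- A finite simple graph: a vertex type, a list enumerating every vertex
-- exactly once, and a Boolean (symmetric, irreflexive) adjacency relation.
record Graph : Set₁ where
  field
    V     : Set
    verts : List V
    adj   : V → V → Bool

open Graph public

VSet : Graph → Set
VSet G = V G → Bool

count : (G : Graph) → (V G → Bool) → ℕ
count G p = length (filterᵇ p (verts G))

size : (G : Graph) → VSet G → ℕ
size G A = count G A

nbrsIn : (G : Graph) → VSet G → V G → ℕ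
nbrsIn G A v = count G (λ u → adj G v u ∧ A u)

step : (G : Graph) → ℕ → VSet G → VSet G
step G r A v = A v ∨ (r ≤ᵇ nbrsIn G A v)

infected : (G : Graph) → ℕ → VSet G → ℕ → VSet G
infected G r A zero = A
infected G r A (suc t) = step G r (infected G r A t)

Percolating : (G : Graph) → ℕ → VSet G → Set
Percolating G r A = ∀ v → ∃ λ t → infected G r A t v ≡ true

IsPercolationNumber : (G : Graph) → ℕ → ℕ → Set
IsPercolationNumber G r k =
  (∃ λ (A : VSet G) → Percolating G r A × size G A ≡ k)
  × (∀ (A : VSet G) → Percolating G r A → k ≤ size G A)

pathAdj : {n : ℕ} → Fin n → Fin n → Bool
pathAdj i j = (suc (toℕ i) ≡ᵇ toℕ j) ∨ (suc (toℕ j) ≡ᵇ toℕ i)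

grid : ℕ → ℕ → Graph
grid a b = record
  { V     = Fin a × Fin b
  ; verts = cartesianProduct (allFin a) (allFin b)
  ; adj   = λ { (i , j) (i' , j') →
               ((toℕ i ≡ᵇ toℕ i') ∧ pathAdj j j') ∨ (pathAdj i i' ∧ (toℕ j ≡ᵇ toℕ j')) }
  }

module Submission where

open import Defs
open import Data.Bool using (Bool; true; false; _∧_; _∨_; not; T; if_then_else_)
open import Data.Bool.Properties using (∨-identityʳ; ∨-idem; ∨-zeroʳ; ∨-comm; ∧-conicalˡ; ∧-conicalʳ; T-≡)
import Data.Bool.Properties as Bool
open import Data.Empty using (⊥-elim)
import Data.Fin as Fin
open Fin using (Fin; toℕ; fromℕ; fromℕ<)
open import Data.Fin.Properties using (toℕ<n; fromℕ<-toℕ; toℕ-fromℕ)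
open import Data.List using (List; []; _∷_; length; filterᵇ; cartesianProduct; tabulate; allFin; map; _++_; head; drop)
open import Data.List.Membership.Propositional using (_∈_)
open import Data.List.Membership.Propositional.Properties using (∈-cartesianProduct⁺; ∈-allFin)
open import Data.List.Properties using (length-++)
open import Data.List.Relation.Unary.All as All using (All; all?)
open import Data.List.Relation.Unary.Any as Any using (Any; here; there; any?)
open import Data.List.Relation.Unary.Any.Properties using (++⁺ˡ; ++⁺ʳ; map⁺)
open import Data.Maybe using (Maybe; just; nothing; maybe)
open import Data.Nat using (ℕ; zero; suc; _+_; _*_; _∸_; _≤_; _<_; _≤ᵇ_; _<ᵇ_; _≡ᵇ_; _≤?_; _<?_; _⊔_; z≤n; s≤s; s≤s⁻¹; z<s)
open import Data.Nat.DivMod using (_/_; _%_; m≡m%n+[m/n]*n; m%n<n; m*n/n≡m; /-monoˡ-≤; m<n*o⇒m/o<n)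
open import Data.Nat.Properties
open import Algebra.Properties.CommutativeSemigroup +-commutativeSemigroup using () renaming (interchange to +-interchange)
open import Data.Nat.Tactic.RingSolver using (solve-∀)
open import Data.Product using (∃; _×_; _,_; proj₁; proj₂)
open import Data.Product.Properties using (≡-dec)
open import Data.Sum using (_⊎_; inj₁; inj₂)
open import Function using (_∘_)
open import Function.Bundles using (Equivalence)
open import Relation.Binary.Definitions using (DecidableEquality)
open import Relation.Binary.PropositionalEquality
open import Relation.Nullary using (Dec; yes; no; ¬_; does)
open import Relation.Nullary.Decidable using (_×-dec_)

-- The lower bound is a potential argument.  For a vertex set S let d(S) = Σ_{v ∈ S} |N(v) ∩ S|, twice the
-- number of edges inside S.  A newly infected vertex has at least three infected neighbours, so d(S) − 6|S|
-- never decreases along the process.  A percolating set A ends with the whole 4 × m grid, where d = 14m − 8 on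
-- 4m vertices, hence 6|A| ≥ 10m + 8 + d(A).  Moreover d(A) ≥ 4: in an end column the corners have only two
-- neighbours and each of the two middle vertices needs the other, so both corners and a middle vertex are
-- seeds and span an edge.  Thus 3|A| ≥ 5m + 6 > 5(m + 1), that is |A| ≥ ⌊5(m + 1)/3⌋ + 1.
--
-- The upper bound ⌊5(m + 1)/3⌋ + 2, and ⌊5(m + 1)/3⌋ + 1 for m = 5, 7, 11, is witnessed by explicit sets, each
-- given by the infection times of all vertices and verified by computation: one for each m ≤ 15 and a family
-- of period 6 beyond.  Which of the two values m(G, 3) takes is decided by enumerating all vertex subsets.

-- Indicators and finite sums

⟦_⟧ : Bool → ℕ
⟦ true ⟧ = 1
⟦ false ⟧ = 0

⟦⟧≤1 : ∀ b → ⟦ b ⟧ ≤ 1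
⟦⟧≤1 true = ≤-refl
⟦⟧≤1 false = z≤n

⟦⟧-mono : ∀ {a b} → (a ≡ true → b ≡ true) → ⟦ a ⟧ ≤ ⟦ b ⟧
⟦⟧-mono {false} _ = z≤n
⟦⟧-mono {true} f rewrite f refl = ≤-refl

⟦∧⟧ : ∀ a b → ⟦ a ∧ b ⟧ ≡ ⟦ a ⟧ * ⟦ b ⟧
⟦∧⟧ true b = sym (+-identityʳ ⟦ b ⟧)
⟦∧⟧ false b = refl

⟦⟧*⟦⟧≤1 : ∀ a b → ⟦ a ⟧ * ⟦ b ⟧ ≤ 1
⟦⟧*⟦⟧≤1 a b = subst (_≤ 1) (⟦∧⟧ a b) (⟦⟧≤1 (a ∧ b))

⟦∧∧⟧ : ∀ a b c → ⟦ (a ∧ b) ∧ c ⟧ ≡ ⟦ a ⟧ * (⟦ b ⟧ * ⟦ c ⟧)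
⟦∧∧⟧ a b c = trans (⟦∧⟧ (a ∧ b) c) (trans (cong (_* ⟦ c ⟧) (⟦∧⟧ a b)) (*-assoc ⟦ a ⟧ ⟦ b ⟧ ⟦ c ⟧))

⟦∨⟧-disjoint : ∀ a b → a ∧ b ≡ false → ⟦ a ∨ b ⟧ ≡ ⟦ a ⟧ + ⟦ b ⟧
⟦∨⟧-disjoint true false _ = refl
⟦∨⟧-disjoint false b _ = refl

⟦∧∨∧⟧ : ∀ e p q f x → e ∧ q ≡ false →
  ⟦ ((e ∧ p) ∨ (q ∧ f)) ∧ x ⟧ ≡ ⟦ e ⟧ * (⟦ p ⟧ * ⟦ x ⟧) + ⟦ q ⟧ * (⟦ f ⟧ * ⟦ x ⟧)
⟦∧∨∧⟧ false p q f x _ = ⟦∧∧⟧ q f x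
⟦∧∨∧⟧ true p false f x _ rewrite ∨-identityʳ p | ⟦∧⟧ p x = sym (trans (+-identityʳ _) (+-identityʳ _))

≤ᵇ≡true⇒≤ : ∀ {m n} → (m ≤ᵇ n) ≡ true → m ≤ n
≤ᵇ≡true⇒≤ {m} {n} e = ≤ᵇ⇒≤ m n (Equivalence.from T-≡ e)

≤⇒≤ᵇ≡true : ∀ {m n} → m ≤ n → (m ≤ᵇ n) ≡ true
≤⇒≤ᵇ≡true {m} {n} m≤n with m ≤ᵇ n | ≤⇒≤ᵇ m≤n
... | true | _ = refl

<⇒≤ᵇ≡false : ∀ {m n} → n < m → (m ≤ᵇ n) ≡ false
<⇒≤ᵇ≡false {m} {n} n<m with m ≤ᵇ n in eq
... | false = refl
... | true = ⊥-elim (<⇒≱ n<m (≤ᵇ≡true⇒≤ eq))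

<⇒⟦<ᵇ⟧≡1 : ∀ {m n} → m < n → ⟦ m <ᵇ n ⟧ ≡ 1
<⇒⟦<ᵇ⟧≡1 {m} {n} m<n with m <ᵇ n | <⇒<ᵇ m<n
... | true | _ = refl

≮⇒⟦<ᵇ⟧≡0 : ∀ {m n} → ¬ m < n → ⟦ m <ᵇ n ⟧ ≡ 0
≮⇒⟦<ᵇ⟧≡0 {m} {n} m≮n with m <ᵇ n in eq
... | false = refl
... | true = ⊥-elim (m≮n (<ᵇ⇒< m n (Equivalence.from T-≡ eq)))

private variable A B : Set

∑ : List A → (A → ℕ) → ℕ
∑ [] f = 0
∑ (x ∷ xs) f = f x + ∑ xs f

length-filterᵇ : (p : A → Bool) (xs : List A) → length (filterᵇ p xs) ≡ ∑ xs (⟦_⟧ ∘ p)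
length-filterᵇ p [] = refl
length-filterᵇ p (x ∷ xs) with p x
... | true = cong suc (length-filterᵇ p xs)
... | false = length-filterᵇ p xs

∑-cong : ∀ (xs : List A) {f g : A → ℕ} → (∀ x → f x ≡ g x) → ∑ xs f ≡ ∑ xs g
∑-cong [] e = refl
∑-cong (x ∷ xs) e = cong₂ _+_ (e x) (∑-cong xs e)

∑-mono : ∀ (xs : List A) {f g : A → ℕ} → (∀ x → f x ≤ g x) → ∑ xs f ≤ ∑ xs g
∑-mono [] e = z≤n
∑-mono (x ∷ xs) e = +-mono-≤ (e x) (∑-mono xs e)

∑-+ : ∀ (xs : List A) (f g : A → ℕ) → ∑ xs (λ x → f x + g x) ≡ ∑ xs f + ∑ xs g
∑-+ [] f g = refl
∑-+ (x ∷ xs) f g rewrite ∑-+ xs f g = +-interchange (f x) (g x) (∑ xs f) (∑ xs g)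

∑-* : ∀ (xs : List A) c (f : A → ℕ) → ∑ xs (λ x → c * f x) ≡ c * ∑ xs f
∑-* [] c f = sym (*-zeroʳ c)
∑-* (x ∷ xs) c f rewrite ∑-* xs c f = sym (*-distribˡ-+ c (f x) (∑ xs f))

∑-0 : ∀ (xs : List A) → ∑ xs (λ _ → 0) ≡ 0
∑-0 [] = refl
∑-0 (x ∷ xs) = ∑-0 xs

∑-1 : ∀ (xs : List A) → ∑ xs (λ _ → 1) ≡ length xs
∑-1 [] = refl
∑-1 (x ∷ xs) = cong suc (∑-1 xs)

∑-++ : ∀ (xs ys : List A) (f : A → ℕ) → ∑ (xs ++ ys) f ≡ ∑ xs f + ∑ ys f
∑-++ [] ys f = refl
∑-++ (x ∷ xs) ys f rewrite ∑-++ xs ys f = sym (+-assoc (f x) (∑ xs f) (∑ ys f))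

∑-map : ∀ (g : A → B) (xs : List A) (f : B → ℕ) → ∑ (map g xs) f ≡ ∑ xs (f ∘ g)
∑-map g [] f = refl
∑-map g (x ∷ xs) f = cong (f (g x) +_) (∑-map g xs f)

∑-cartesianProduct : ∀ (xs : List A) (ys : List B) (f : A × B → ℕ) →
  ∑ (cartesianProduct xs ys) f ≡ ∑ xs (λ x → ∑ ys (λ y → f (x , y)))
∑-cartesianProduct [] ys f = refl
∑-cartesianProduct (x ∷ xs) ys f = trans (∑-++ (map (x ,_) ys) _ f)
  (cong₂ _+_ (∑-map (x ,_) ys f) (∑-cartesianProduct xs ys f))

∑-comm : ∀ (xs : List A) (ys : List B) (f : A → B → ℕ) →
  ∑ xs (λ x → ∑ ys (f x)) ≡ ∑ ys (λ y → ∑ xs (λ x → f x y))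
∑-comm [] ys f = sym (∑-0 ys)
∑-comm (x ∷ xs) ys f = trans (cong (∑ ys (f x) +_) (∑-comm xs ys f))
  (sym (∑-+ ys (f x) (λ y → ∑ xs (λ x′ → f x′ y))))

⊆⇒agree⊎∑< : ∀ {p q : A → Bool} → (∀ x → p x ≡ true → q x ≡ true) → ∀ xs →
  (∀ x → x ∈ xs → q x ≡ p x) ⊎ ∑ xs (⟦_⟧ ∘ p) < ∑ xs (⟦_⟧ ∘ q)
⊆⇒agree⊎∑< p⊆q [] = inj₁ (λ _ ())
⊆⇒agree⊎∑< {p = p} {q = q} p⊆q (x ∷ xs) with p x in px | q x in qx | ⊆⇒agree⊎∑< p⊆q xs
... | true | false | _ with () ← trans (sym (p⊆q x px)) qx
... | false | true | _ = inj₂ (s≤s (∑-mono xs (λ y → ⟦⟧-mono (p⊆q y))))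
... | true | true | inj₂ lt = inj₂ (s≤s lt)
... | false | false | inj₂ lt = inj₂ lt
... | true | true | inj₁ agree = inj₁ λ where
  y (here refl) → trans qx (sym px)
  y (there y∈xs) → agree y y∈xs
... | false | false | inj₁ agree = inj₁ λ where
  y (here refl) → trans qx (sym px)
  y (there y∈xs) → agree y y∈xs

∑< : ℕ → (ℕ → ℕ) → ℕ
∑< zero f = 0
∑< (suc n) f = f 0 + ∑< n (f ∘ suc)

∑-tabulate : ∀ n (g : Fin n → A) (h : A → ℕ) (f : ℕ → ℕ) →
  (∀ i → h (g i) ≡ f (toℕ i)) → ∑ (tabulate g) h ≡ ∑< n f
∑-tabulate zero g h f e = refl
∑-tabulate (suc n) g h f e = cong₂ _+_ (e Fin.zero) (∑-tabulate n (g ∘ Fin.suc) h (f ∘ suc) (e ∘ Fin.suc))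

∑-allFin : ∀ n (f : ℕ → ℕ) → ∑ (allFin n) (f ∘ toℕ) ≡ ∑< n f
∑-allFin n f = ∑-tabulate n (λ i → i) (f ∘ toℕ) f (λ _ → refl)

∑<-cong : ∀ n {f g : ℕ → ℕ} → (∀ k → f k ≡ g k) → ∑< n f ≡ ∑< n g
∑<-cong zero e = refl
∑<-cong (suc n) e = cong₂ _+_ (e 0) (∑<-cong n (e ∘ suc))

∑<-mono : ∀ n {f g : ℕ → ℕ} → (∀ k → f k ≤ g k) → ∑< n f ≤ ∑< n g
∑<-mono zero e = z≤n
∑<-mono (suc n) e = +-mono-≤ (e 0) (∑<-mono n (e ∘ suc))

∑<-+ : ∀ n (f g : ℕ → ℕ) → ∑< n (λ k → f k + g k) ≡ ∑< n f + ∑< n g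
∑<-+ zero f g = refl
∑<-+ (suc n) f g rewrite ∑<-+ n (f ∘ suc) (g ∘ suc) = +-interchange (f 0) (g 0) _ _

∑<-* : ∀ n c (f : ℕ → ℕ) → ∑< n (λ k → c * f k) ≡ c * ∑< n f
∑<-* zero c f = sym (*-zeroʳ c)
∑<-* (suc n) c f rewrite ∑<-* n c (f ∘ suc) = sym (*-distribˡ-+ c (f 0) _)

∑<-const : ∀ n c → ∑< n (λ _ → c) ≡ n * c
∑<-const zero c = refl
∑<-const (suc n) c = cong (c +_) (∑<-const n c)

∑<-last : ∀ n (f : ℕ → ℕ) → f n ≤ ∑< (suc n) f
∑<-last zero f = m≤m+n (f 0) 0
∑<-last (suc n) f = ≤-trans (∑<-last n (f ∘ suc)) (m≤n+m _ (f 0))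

∑<-ends : ∀ n (f : ℕ → ℕ) → f 0 + f (suc n) ≤ ∑< (suc (suc n)) f
∑<-ends n f = +-monoʳ-≤ (f 0) (∑<-last n (f ∘ suc))

∑<-<ᵇ : ∀ n → ∑< (suc n) (λ k → ⟦ k <ᵇ n ⟧) ≡ n
∑<-<ᵇ zero = refl
∑<-<ᵇ (suc n) = cong suc (∑<-<ᵇ n)

∑<-∑-comm : ∀ n (xs : List A) (f : ℕ → A → ℕ) → ∑< n (λ a → ∑ xs (f a)) ≡ ∑ xs (λ x → ∑< n (λ a → f a x))
∑<-∑-comm zero xs f = sym (∑-0 xs)
∑<-∑-comm (suc n) xs f = trans (cong (∑ xs (f 0) +_) (∑<-∑-comm n xs (f ∘ suc))) (sym (∑-+ xs (f 0) _))

-- Bootstrap percolation on finite graphs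

module _ (G : Graph) where

  nbrsIn≡∑ : ∀ S v → nbrsIn G S v ≡ ∑ (verts G) (λ u → ⟦ adj G v u ⟧ * ⟦ S u ⟧)
  nbrsIn≡∑ S v = trans (length-filterᵇ _ (verts G)) (∑-cong (verts G) (λ u → ⟦∧⟧ (adj G v u) (S u)))

  nbrsIn-mono : ∀ {S T : VSet G} v → (∀ u → S u ≡ true → T u ≡ true) → nbrsIn G S v ≤ nbrsIn G T v
  nbrsIn-mono {S} {T} v S⊆T rewrite nbrsIn≡∑ S v | nbrsIn≡∑ T v =
    ∑-mono (verts G) (λ u → *-monoʳ-≤ ⟦ adj G v u ⟧ (⟦⟧-mono (S⊆T u)))

  nbrsIn-cong : ∀ {S T : VSet G} v → (∀ u → S u ≡ T u) → nbrsIn G S v ≡ nbrsIn G T v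
  nbrsIn-cong {S} {T} v e = trans (nbrsIn≡∑ S v)
    (trans (∑-cong (verts G) (λ u → cong (λ b → ⟦ adj G v u ⟧ * ⟦ b ⟧) (e u))) (sym (nbrsIn≡∑ T v)))

  size-cong : ∀ {S T : VSet G} → (∀ u → S u ≡ T u) → size G S ≡ size G T
  size-cong {S} {T} e = trans (length-filterᵇ S (verts G))
    (trans (∑-cong (verts G) (cong ⟦_⟧ ∘ e)) (sym (length-filterᵇ T (verts G))))

  size≤length : ∀ (S : VSet G) → size G S ≤ length (verts G)
  size≤length S = begin
    size G S                    ≡⟨ length-filterᵇ S (verts G) ⟩
    ∑ (verts G) (⟦_⟧ ∘ S)       ≤⟨ ∑-mono (verts G) (⟦⟧≤1 ∘ S) ⟩
    ∑ (verts G) (λ _ → 1)       ≡⟨ ∑-1 (verts G) ⟩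
    length (verts G)            ∎
    where open ≤-Reasoning

  nbrsIn-split : ∀ {S T U : VSet G} v → (∀ u → ⟦ S u ⟧ ≡ ⟦ T u ⟧ + ⟦ U u ⟧) →
    nbrsIn G S v ≡ nbrsIn G T v + nbrsIn G U v
  nbrsIn-split {S} {T} {U} v e = begin
    nbrsIn G S v
      ≡⟨ nbrsIn≡∑ S v ⟩
    ∑ (verts G) (λ u → ⟦ adj G v u ⟧ * ⟦ S u ⟧)
      ≡⟨ ∑-cong (verts G) (λ u → trans (cong (⟦ adj G v u ⟧ *_) (e u)) (*-distribˡ-+ ⟦ adj G v u ⟧ _ _)) ⟩
    ∑ (verts G) (λ u → ⟦ adj G v u ⟧ * ⟦ T u ⟧ + ⟦ adj G v u ⟧ * ⟦ U u ⟧)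
      ≡⟨ ∑-+ (verts G) _ _ ⟩
    ∑ (verts G) (λ u → ⟦ adj G v u ⟧ * ⟦ T u ⟧) + ∑ (verts G) (λ u → ⟦ adj G v u ⟧ * ⟦ U u ⟧)
      ≡⟨ cong₂ _+_ (nbrsIn≡∑ T v) (nbrsIn≡∑ U v) ⟨
    nbrsIn G T v + nbrsIn G U v ∎
    where open ≡-Reasoning

  size-split : ∀ {S T U : VSet G} → (∀ u → ⟦ S u ⟧ ≡ ⟦ T u ⟧ + ⟦ U u ⟧) → size G S ≡ size G T + size G U
  size-split {S} {T} {U} e = begin
    size G S                                 ≡⟨ length-filterᵇ S (verts G) ⟩
    ∑ (verts G) (⟦_⟧ ∘ S)                    ≡⟨ ∑-cong (verts G) e ⟩
    ∑ (verts G) (λ u → ⟦ T u ⟧ + ⟦ U u ⟧)    ≡⟨ ∑-+ (verts G) _ _ ⟩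
    ∑ (verts G) (⟦_⟧ ∘ T) + ∑ (verts G) (⟦_⟧ ∘ U)
      ≡⟨ sym (cong₂ _+_ (length-filterᵇ T (verts G)) (length-filterᵇ U (verts G))) ⟩
    size G T + size G U                      ∎
    where open ≡-Reasoning

module _ (G : Graph) (r : ℕ) {A : VSet G} where

  infected-suc : ∀ {t v} → infected G r A t v ≡ true → infected G r A (suc t) v ≡ true
  infected-suc e rewrite e = refl

  infected-mono : ∀ {s t v} → s ≤ t → infected G r A s v ≡ true → infected G r A t v ≡ true
  infected-mono {s} {zero} z≤n e = e
  infected-mono {s} {suc t} s≤1+t e with s ≤? t
  ... | yes s≤t = infected-suc {t} (infected-mono s≤t e)
  ... | no s≰t rewrite ≤-antisym s≤1+t (≰⇒> s≰t) = e

  eventually-all-infected : ∀ (L : List (V G)) → Percolating G r A →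
    ∃ λ T → ∀ v → v ∈ L → infected G r A T v ≡ true
  eventually-all-infected [] P = 0 , λ _ ()
  eventually-all-infected (x ∷ L) P with eventually-all-infected L P | P x
  ... | T , allL | t , xt = T ⊔ t , λ where
    v (here refl) → infected-mono (m≤n⊔m T t) xt
    v (there v∈L) → infected-mono (m≤m⊔n T t) (allL v v∈L)

  stay-uninfected : ∀ {u v} →
    (∀ S → S v ≡ false → nbrsIn G S u < r) → (∀ S → S u ≡ false → nbrsIn G S v < r) →
    A u ≡ false → A v ≡ false → ∀ t → infected G r A t u ≡ false × infected G r A t v ≡ false
  stay-uninfected hu hv au av zero = au , av
  stay-uninfected hu hv au av (suc t) with stay-uninfected hu hv au av t
  ... | iu , iv rewrite iu | iv = <⇒≤ᵇ≡false (hu _ iv) , <⇒≤ᵇ≡false (hv _ iu)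

  pair-contains-seed : ∀ {u v} → Percolating G r A →
    (∀ S → S v ≡ false → nbrsIn G S u < r) → (∀ S → S u ≡ false → nbrsIn G S v < r) →
    A u ∨ A v ≡ true
  pair-contains-seed {u} {v} P hu hv with A u in au | A v in av
  ... | true | _ = refl
  ... | false | true = refl
  ... | false | false with P u
  ... | t , ut with () ← trans (sym ut) (proj₁ (stay-uninfected hu hv au av t))

  must-be-seed : ∀ {v} → Percolating G r A → (∀ S → S v ≡ false → nbrsIn G S v < r) → A v ≡ true
  must-be-seed {v} P h = trans (sym (∨-idem (A v))) (pair-contains-seed P h h)

module _ (G : Graph) (r : ℕ) where

  IsSchedule : (V G → ℕ) → Set
  IsSchedule τ = ∀ v → 0 < τ v → r ≤ nbrsIn G (λ u → τ u <ᵇ τ v) v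

  schedule-percolates : ∀ {τ} → IsSchedule τ → Percolating G r (λ v → τ v ≡ᵇ 0)
  schedule-percolates {τ} sched v = τ v , infected-by (τ v) v ≤-refl
    where
    seeds : VSet G
    seeds v = τ v ≡ᵇ 0
    infected-by : ∀ t v → τ v ≤ t → infected G r seeds t v ≡ true
    infected-by zero v τv≤0 rewrite n≤0⇒n≡0 τv≤0 = refl
    infected-by (suc t) v τv≤1+t with τ v ≤? t
    ... | yes τv≤t = infected-suc G r {t = t} (infected-by t v τv≤t)
    ... | no τv≰t = trans (cong (infected G r seeds t v ∨_) (≤⇒≤ᵇ≡true r≤nbrs)) (∨-zeroʳ _)
      where
      τv≡1+t : τ v ≡ suc t
      τv≡1+t = ≤-antisym τv≤1+t (≰⇒> τv≰t)
      earlier : ∀ u → (τ u <ᵇ τ v) ≡ true → infected G r seeds t u ≡ true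
      earlier u e = infected-by t u (s≤s⁻¹ (subst (τ u <_) τv≡1+t (<ᵇ⇒< _ _ (Equivalence.from T-≡ e))))
      r≤nbrs : r ≤ nbrsIn G (infected G r seeds t) v
      r≤nbrs = ≤-trans (sched v (subst (0 <_) (sym τv≡1+t) z<s)) (nbrsIn-mono G v earlier)

  step-cong : ∀ {S T : VSet G} → (∀ v → S v ≡ T v) → ∀ v → step G r S v ≡ step G r T v
  step-cong S≈T v = cong₂ _∨_ (S≈T v) (cong (r ≤ᵇ_) (nbrsIn-cong G v S≈T))

  infected-cong : ∀ {A B : VSet G} → (∀ v → A v ≡ B v) → ∀ t v → infected G r A t v ≡ infected G r B t v
  infected-cong A≈B zero = A≈B
  infected-cong A≈B (suc t) = step-cong (infected-cong A≈B t)

module _ (G : Graph) (r : ℕ) {A : VSet G} (complete : ∀ v → v ∈ verts G) where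

  private
    I = infected G r A

  Stable : ℕ → Set
  Stable s = ∀ v → I (suc s) v ≡ I s v

  stable-forever : ∀ {s} → Stable s → ∀ k v → I (k + s) v ≡ I s v
  stable-forever st zero v = refl
  stable-forever st (suc k) v = trans (step-cong G r (stable-forever st k) v) (st v)

  stable⊎grown : ∀ t → (∃ λ s → s ≤ t × Stable s) ⊎ t ≤ size G (I t)
  stable⊎grown zero = inj₂ z≤n
  stable⊎grown (suc t) with stable⊎grown t
  ... | inj₁ (s , s≤t , st) = inj₁ (s , m≤n⇒m≤1+n s≤t , st)
  ... | inj₂ t≤size with ⊆⇒agree⊎∑< (λ v → infected-suc G r {t = t} {v}) (verts G)
  ...   | inj₁ agree = inj₁ (t , n≤1+n t , λ v → agree v (complete v))
  ...   | inj₂ grown = inj₂ (<-≤-trans (s≤s t≤size)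
                           (subst₂ _<_ (sym (length-filterᵇ (I t) (verts G))) (sym (length-filterᵇ (I (suc t)) (verts G))) grown))

  percolating⇒infected-at : Percolating G r A → ∀ v → I (suc (length (verts G))) v ≡ true
  percolating⇒infected-at P v with stable⊎grown (suc (length (verts G))) | P v
  ... | inj₂ too-big | _ = ⊥-elim (<-irrefl refl (≤-trans too-big (size≤length G _)))
  ... | inj₁ (s , s≤N , st) | t , vt with t ≤? suc (length (verts G))
  ...   | yes t≤N = infected-mono G r t≤N vt
  ...   | no t≰N = infected-mono G r s≤N (trans (sym (stable-forever st (t ∸ s) v))
                      (subst (λ t′ → I t′ v ≡ true) (sym (m∸n+n≡m s≤t)) vt))
    where
    s≤t : s ≤ t
    s≤t = ≤-trans s≤N (<⇒≤ (≰⇒> t≰N))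

-- The degree-sum potential

degreeSum : (G : Graph) → VSet G → ℕ
degreeSum G S = ∑ (verts G) (λ v → ⟦ S v ⟧ * nbrsIn G S v)

module _ {G : Graph} (adj-sym : ∀ u v → adj G u v ≡ adj G v u) where

  private Vs = verts G

  ∑-nbrsIn-comm : ∀ (S T : VSet G) → ∑ Vs (λ v → ⟦ S v ⟧ * nbrsIn G T v) ≡ ∑ Vs (λ v → ⟦ T v ⟧ * nbrsIn G S v)
  ∑-nbrsIn-comm S T = begin
    ∑ Vs (λ v → ⟦ S v ⟧ * nbrsIn G T v)
      ≡⟨ ∑-cong Vs (λ v → trans (cong (⟦ S v ⟧ *_) (nbrsIn≡∑ G T v)) (sym (∑-* Vs ⟦ S v ⟧ _))) ⟩
    ∑ Vs (λ v → ∑ Vs (λ u → ⟦ S v ⟧ * (⟦ adj G v u ⟧ * ⟦ T u ⟧)))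
      ≡⟨ ∑-comm Vs Vs _ ⟩
    ∑ Vs (λ u → ∑ Vs (λ v → ⟦ S v ⟧ * (⟦ adj G v u ⟧ * ⟦ T u ⟧)))
      ≡⟨ ∑-cong Vs (λ u → ∑-cong Vs (λ v →
           trans (cong (λ b → ⟦ S v ⟧ * (⟦ b ⟧ * ⟦ T u ⟧)) (adj-sym v u)) (swap ⟦ S v ⟧ ⟦ adj G u v ⟧ ⟦ T u ⟧))) ⟩
    ∑ Vs (λ u → ∑ Vs (λ v → ⟦ T u ⟧ * (⟦ adj G u v ⟧ * ⟦ S v ⟧)))
      ≡⟨ ∑-cong Vs (λ u → trans (∑-* Vs ⟦ T u ⟧ _) (cong (⟦ T u ⟧ *_) (sym (nbrsIn≡∑ G S u)))) ⟩
    ∑ Vs (λ v → ⟦ T v ⟧ * nbrsIn G S v) ∎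
    where
    open ≡-Reasoning
    swap : ∀ s a t → s * (a * t) ≡ t * (a * s)
    swap = solve-∀

  -- With D the newly infected vertices, each v ∈ D has at least r neighbours in S, and the edges between
  -- S and D enter the degree sum twice, once from each side.
  degreeSum-step : ∀ r S → degreeSum G S + 2 * r * size G (step G r S) ≤ degreeSum G (step G r S) + 2 * r * size G S
  degreeSum-step r S = begin
    degreeSum G S + 2 * r * size G S′                  ≡⟨ cong (λ n → degreeSum G S + 2 * r * n) (size-split G S′≡S+D) ⟩
    degreeSum G S + 2 * r * (size G S + size G D)      ≡⟨ arith (degreeSum G S) r (size G S) (size G D) ⟩
    degreeSum G S + r * size G D + r * size G D + 2 * r * size G S
      ≤⟨ +-monoˡ-≤ (2 * r * size G S) (+-mono-≤ (+-monoʳ-≤ (degreeSum G S) r|D|≤cross) r|D|≤cross) ⟩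
    degreeSum G S + cross + cross + 2 * r * size G S   ≤⟨ +-monoˡ-≤ (2 * r * size G S) gain ⟩
    degreeSum G S′ + 2 * r * size G S                  ∎
    where
    open ≤-Reasoning
    S′ = step G r S
    D : VSet G
    D v = not (S v) ∧ (r ≤ᵇ nbrsIn G S v)
    S′≡S+D : ∀ v → ⟦ S′ v ⟧ ≡ ⟦ S v ⟧ + ⟦ D v ⟧
    S′≡S+D v with S v
    ... | true = refl
    ... | false = refl
    cross : ℕ
    cross = ∑ Vs (λ v → ⟦ D v ⟧ * nbrsIn G S v)
    r≤nbrs : ∀ v → r * ⟦ D v ⟧ ≤ ⟦ D v ⟧ * nbrsIn G S v
    r≤nbrs v with S v | r ≤ᵇ nbrsIn G S v in r≤ᵇ
    ... | true | _ = ≤-reflexive (*-zeroʳ r)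
    ... | false | false = ≤-reflexive (*-zeroʳ r)
    ... | false | true = subst₂ _≤_ (sym (*-identityʳ r)) (sym (*-identityˡ _)) (≤ᵇ≡true⇒≤ r≤ᵇ)
    r|D|≤cross : r * size G D ≤ cross
    r|D|≤cross = ≤-trans (≤-reflexive (trans (cong (r *_) (length-filterᵇ D Vs)) (sym (∑-* Vs r _)))) (∑-mono Vs r≤nbrs)
    pointwise : ∀ v → ⟦ S v ⟧ * nbrsIn G S v + ⟦ S v ⟧ * nbrsIn G D v + ⟦ D v ⟧ * nbrsIn G S v ≤ ⟦ S′ v ⟧ * nbrsIn G S′ v
    pointwise v = subst (⟦ S v ⟧ * nbrsIn G S v + ⟦ S v ⟧ * nbrsIn G D v + ⟦ D v ⟧ * nbrsIn G S v ≤_)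
      (sym (cong₂ _*_ (S′≡S+D v) (nbrsIn-split G v S′≡S+D)))
      (≤-trans (m≤m+n _ _) (≤-reflexive (expand ⟦ S v ⟧ ⟦ D v ⟧ (nbrsIn G S v) (nbrsIn G D v))))
      where
      expand : ∀ s d x y → s * x + s * y + d * x + d * y ≡ (s + d) * (x + y)
      expand = solve-∀
    gain : degreeSum G S + cross + cross ≤ degreeSum G S′
    gain = begin
      degreeSum G S + cross + cross
        ≡⟨ cong (λ n → degreeSum G S + n + cross) (∑-nbrsIn-comm S D) ⟨
      degreeSum G S + ∑ Vs (λ v → ⟦ S v ⟧ * nbrsIn G D v) + cross
        ≡⟨ trans (∑-+ Vs _ _) (cong (_+ cross) (∑-+ Vs _ _)) ⟨
      ∑ Vs (λ v → ⟦ S v ⟧ * nbrsIn G S v + ⟦ S v ⟧ * nbrsIn G D v + ⟦ D v ⟧ * nbrsIn G S v)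
        ≤⟨ ∑-mono Vs pointwise ⟩
      degreeSum G S′ ∎
    arith : ∀ e r s d → e + 2 * r * (s + d) ≡ e + r * d + r * d + 2 * r * s
    arith = solve-∀

  degreeSum-infected : ∀ r A t →
    degreeSum G A + 2 * r * size G (infected G r A t) ≤ degreeSum G (infected G r A t) + 2 * r * size G A
  degreeSum-infected r A zero = ≤-refl
  degreeSum-infected r A (suc t) =
    chain {b = 2 * r * size G (infected G r A t)} {c = degreeSum G (infected G r A t)}
      (degreeSum-infected r A t) (degreeSum-step r (infected G r A t))
    where
    chain : ∀ {a b c d e f} → a + b ≤ c + d → c + e ≤ f + b → a + e ≤ f + d
    chain {a} {b} {c} {d} {e} {f} p q = +-cancelʳ-≤ (b + c) (a + e) (f + d)
      (subst₂ _≤_ (shuffle₁ a b c e) (shuffle₂ c d f b) (+-mono-≤ p q))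
      where
      shuffle₁ : ∀ a b c e → (a + b) + (c + e) ≡ a + e + (b + c)
      shuffle₁ = solve-∀
      shuffle₂ : ∀ c d f b → (c + d) + (f + b) ≡ f + d + (b + c)
      shuffle₂ = solve-∀

  percolating-degreeSum : (∀ v → v ∈ Vs) → ∀ r A → Percolating G r A →
    degreeSum G A + 2 * r * length Vs ≤ degreeSum G (λ _ → true) + 2 * r * size G A
  percolating-degreeSum complete r A P with eventually-all-infected G r Vs P
  ... | T , all-at-T = subst₂ (λ n d → degreeSum G A + 2 * r * n ≤ d + 2 * r * size G A)
    (trans (size-cong G all) (trans (length-filterᵇ _ Vs) (∑-1 Vs)))
    (∑-cong Vs (λ v → cong₂ (λ b n → ⟦ b ⟧ * n) (all v) (nbrsIn-cong G v all)))
    (degreeSum-infected r A T)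
    where
    all : ∀ v → infected G r A T v ≡ true
    all v = all-at-T v (complete v)

-- Deciding m(G, r) ≤ L

PercolationNumber≤ : Graph → ℕ → ℕ → Set
PercolationNumber≤ G r L = ∃ λ A → Percolating G r A × size G A ≤ L

module _ {X : Set} (_≟_ : DecidableEquality X) where

  _[_≔_] : (X → Bool) → X → Bool → (X → Bool)
  (S [ x ≔ b ]) v = if does (v ≟ x) then b else S v

  subsets : List X → List (X → Bool)
  subsets [] = (λ _ → false) ∷ []
  subsets (x ∷ xs) = map (_[ x ≔ true ]) (subsets xs) ++ map (_[ x ≔ false ]) (subsets xs)

  subsets-complete : ∀ xs (A : X → Bool) → Any (λ S → ∀ v → v ∈ xs → S v ≡ A v) (subsets xs)
  subsets-complete [] A = here (λ _ ())
  subsets-complete (x ∷ xs) A = pick (A x) refl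
    where
    agree : ∀ {S b} → A x ≡ b → (∀ v → v ∈ xs → S v ≡ A v) → ∀ v → v ∈ x ∷ xs → (S [ x ≔ b ]) v ≡ A v
    agree Ax≡b S≈A v v∈x∷xs with v ≟ x | v∈x∷xs
    ... | yes refl | _ = sym Ax≡b
    ... | no v≢x | here v≡x = ⊥-elim (v≢x v≡x)
    ... | no v≢x | there v∈xs = S≈A v v∈xs
    pick : ∀ b → A x ≡ b → Any (λ S → ∀ v → v ∈ x ∷ xs → S v ≡ A v) (subsets (x ∷ xs))
    pick true e = ++⁺ˡ (map⁺ (Any.map (agree e) (subsets-complete xs A)))
    pick false e = ++⁺ʳ _ (map⁺ (Any.map (agree e) (subsets-complete xs A)))

module _ (G : Graph) (r : ℕ) (_≟_ : DecidableEquality (V G)) (complete : ∀ v → v ∈ verts G) where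

  private
    Vs = verts G
    finish = suc (length Vs)

    Witness : ℕ → VSet G → Set
    Witness L S = All (λ v → infected G r S finish v ≡ true) Vs × size G S ≤ L

    witness? : ∀ L S → Dec (Witness L S)
    witness? L S = all? (λ v → infected G r S finish v Bool.≟ true) Vs ×-dec (size G S ≤? L)

    witness : ∀ {L S A} → (∀ v → v ∈ Vs → S v ≡ A v) → Percolating G r A → size G A ≤ L → Witness L S
    witness {S = S} {A} S≈A P small =
      All.tabulate (λ {v} _ → trans (infected-cong G r S≈A′ finish v) (percolating⇒infected-at G r complete P v)) ,
      ≤-trans (≤-reflexive (size-cong G S≈A′)) small
      where
      S≈A′ : ∀ v → S v ≡ A v
      S≈A′ v = S≈A v (complete v)

  percolationNumber≤? : ∀ L → Dec (PercolationNumber≤ G r L)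
  percolationNumber≤? L with any? (witness? L) (subsets _≟_ Vs)
  ... | yes w with S , (all , small) ← Any.satisfied w = yes (S , (λ v → finish , All.lookup all (complete v)) , small)
  ... | no ¬w = no λ (A , P , small) → ¬w (Any.map (λ S≈A → witness S≈A P small) (subsets-complete _≟_ Vs A))

percolationNumber-dichotomy : ∀ {G r L} → Dec (PercolationNumber≤ G r L) →
  (∀ A → Percolating G r A → L ≤ size G A) → PercolationNumber≤ G r (suc L) →
  IsPercolationNumber G r L ⊎ (IsPercolationNumber G r (suc L) × ¬ PercolationNumber≤ G r L)
percolationNumber-dichotomy (yes (A , P , small)) lower _ = inj₁ ((A , P , ≤-antisym small (lower A P)) , lower)
percolationNumber-dichotomy {G} {L = L} (no ¬small) _ (B , PB , B≤1+L) =
  inj₂ (((B , PB , ≤-antisym B≤1+L (above PB)) , (λ _ → above)) , ¬small)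
  where
  above : ∀ {A} → Percolating G _ A → suc L ≤ size G A
  above {A} P with size G A ≤? L
  ... | yes small = ⊥-elim (¬small (A , P , small))
  ... | no ¬small′ = ≰⇒> ¬small′

-- Neighbour counts in grids

atPred : ℕ → (ℕ → ℕ) → ℕ
atPred zero f = 0
atPred (suc b) f = f b

pathCount : ℕ → ℕ → (ℕ → Bool) → ℕ
pathCount m b q = ⟦ suc b <ᵇ m ⟧ * ⟦ q (suc b) ⟧ + atPred b (⟦_⟧ ∘ q)

gridCount : ℕ → ℕ → ℕ → ℕ → (ℕ → ℕ → Bool) → ℕ
gridCount n m a b q = pathCount m b (q a) + pathCount n a (λ a′ → q a′ b)

∑<-δ : ∀ n c (f : ℕ → ℕ) → ∑< n (λ k → ⟦ c ≡ᵇ k ⟧ * f k) ≡ ⟦ c <ᵇ n ⟧ * f c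
∑<-δ zero c f = refl
∑<-δ (suc n) zero f = trans (cong (f 0 + 0 +_) (trans (∑<-const n 0) (*-zeroʳ n))) (+-identityʳ _)
∑<-δ (suc n) (suc c) f = ∑<-δ n c (f ∘ suc)

∑<-δ-suc : ∀ n c (f : ℕ → ℕ) → ∑< n (λ k → ⟦ suc k ≡ᵇ c ⟧ * f k) ≡ atPred c (λ k → ⟦ k <ᵇ n ⟧ * f k)
∑<-δ-suc zero zero f = refl
∑<-δ-suc zero (suc c) f = refl
∑<-δ-suc (suc n) zero f = trans (∑<-const n 0) (*-zeroʳ n)
∑<-δ-suc (suc n) (suc c) f = trans (cong (⟦ 0 ≡ᵇ c ⟧ * f 0 +_) (∑<-δ-suc n c (f ∘ suc))) (shift c)
  where
  shift : ∀ c → ⟦ 0 ≡ᵇ c ⟧ * f 0 + atPred c (λ k → ⟦ k <ᵇ n ⟧ * f (suc k)) ≡ ⟦ c <ᵇ suc n ⟧ * f c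
  shift zero = +-identityʳ _
  shift (suc c) = refl

∑<-δ-at : ∀ {n b} (f : ℕ → ℕ) → b < n → ∑< n (λ k → ⟦ b ≡ᵇ k ⟧ * f k) ≡ f b
∑<-δ-at {n} {b} f b<n = begin
  ∑< n (λ k → ⟦ b ≡ᵇ k ⟧ * f k)  ≡⟨ ∑<-δ n b f ⟩
  ⟦ b <ᵇ n ⟧ * f b               ≡⟨ cong (_* f b) (<⇒⟦<ᵇ⟧≡1 b<n) ⟩
  1 * f b                        ≡⟨ *-identityˡ (f b) ⟩
  f b                            ∎
  where open ≡-Reasoning

∑<-path : ∀ {n b} (q : ℕ → Bool) → b < n →
  ∑< n (λ k → (⟦ suc b ≡ᵇ k ⟧ + ⟦ suc k ≡ᵇ b ⟧) * ⟦ q k ⟧) ≡ pathCount n b q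
∑<-path {n} {b} q b<n = begin
  ∑< n (λ k → (⟦ suc b ≡ᵇ k ⟧ + ⟦ suc k ≡ᵇ b ⟧) * ⟦ q k ⟧)
    ≡⟨ ∑<-cong n (λ k → *-distribʳ-+ ⟦ q k ⟧ ⟦ suc b ≡ᵇ k ⟧ ⟦ suc k ≡ᵇ b ⟧) ⟩
  ∑< n (λ k → ⟦ suc b ≡ᵇ k ⟧ * ⟦ q k ⟧ + ⟦ suc k ≡ᵇ b ⟧ * ⟦ q k ⟧)
    ≡⟨ ∑<-+ n _ _ ⟩
  ∑< n (λ k → ⟦ suc b ≡ᵇ k ⟧ * ⟦ q k ⟧) + ∑< n (λ k → ⟦ suc k ≡ᵇ b ⟧ * ⟦ q k ⟧)
    ≡⟨ cong₂ _+_ (∑<-δ n (suc b) (⟦_⟧ ∘ q)) (∑<-δ-suc n b (⟦_⟧ ∘ q)) ⟩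
  ⟦ suc b <ᵇ n ⟧ * ⟦ q (suc b) ⟧ + atPred b (λ k → ⟦ k <ᵇ n ⟧ * ⟦ q k ⟧)
    ≡⟨ cong (⟦ suc b <ᵇ n ⟧ * ⟦ q (suc b) ⟧ +_) (below b b<n) ⟩
  pathCount n b q ∎
  where
  open ≡-Reasoning
  below : ∀ b → b < n → atPred b (λ k → ⟦ k <ᵇ n ⟧ * ⟦ q k ⟧) ≡ atPred b (⟦_⟧ ∘ q)
  below zero _ = refl
  below (suc b) b<n = trans (cong (_* ⟦ q b ⟧) (<⇒⟦<ᵇ⟧≡1 (<-trans (n<1+n b) b<n))) (*-identityˡ ⟦ q b ⟧)

suc≡ᵇ-asym : ∀ x y → (suc x ≡ᵇ y) ∧ (suc y ≡ᵇ x) ≡ false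
suc≡ᵇ-asym zero zero = refl
suc≡ᵇ-asym zero (suc zero) = refl
suc≡ᵇ-asym zero (suc (suc y)) = refl
suc≡ᵇ-asym (suc x) zero = refl
suc≡ᵇ-asym (suc x) (suc y) = suc≡ᵇ-asym x y

≡ᵇ∧adjacent≡false : ∀ x y → (x ≡ᵇ y) ∧ ((suc x ≡ᵇ y) ∨ (suc y ≡ᵇ x)) ≡ false
≡ᵇ∧adjacent≡false zero zero = refl
≡ᵇ∧adjacent≡false zero (suc y) = refl
≡ᵇ∧adjacent≡false (suc x) zero = refl
≡ᵇ∧adjacent≡false (suc x) (suc y) = ≡ᵇ∧adjacent≡false x y

⟦adjacent⟧ : ∀ x y → ⟦ (suc x ≡ᵇ y) ∨ (suc y ≡ᵇ x) ⟧ ≡ ⟦ suc x ≡ᵇ y ⟧ + ⟦ suc y ≡ᵇ x ⟧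
⟦adjacent⟧ x y = ⟦∨⟧-disjoint (suc x ≡ᵇ y) (suc y ≡ᵇ x) (suc≡ᵇ-asym x y)

∑-grid : ∀ n m (f : ℕ → ℕ → ℕ) →
  ∑ (verts (grid n m)) (λ u → f (toℕ (proj₁ u)) (toℕ (proj₂ u))) ≡ ∑< n (λ a → ∑< m (f a))
∑-grid n m f = trans (∑-cartesianProduct (allFin n) (allFin m) _)
  (trans (∑-cong (allFin n) (λ i → ∑-allFin m (f (toℕ i)))) (∑-allFin n (λ a → ∑< m (f a))))

grid-count : ∀ {n m} (i : Fin n) (j : Fin m) (q : ℕ → ℕ → Bool) →
  ∑ (verts (grid n m)) (λ u → ⟦ adj (grid n m) (i , j) u ∧ q (toℕ (proj₁ u)) (toℕ (proj₂ u)) ⟧)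
    ≡ gridCount n m (toℕ i) (toℕ j) q
grid-count {n} {m} i j q = begin
  ∑ (verts (grid n m)) (λ u → ⟦ adj (grid n m) (i , j) u ∧ q (toℕ (proj₁ u)) (toℕ (proj₂ u)) ⟧)
    ≡⟨ ∑-grid n m _ ⟩
  ∑< n (λ a′ → ∑< m (λ b′ → ⟦ (((a ≡ᵇ a′) ∧ adjacent b b′) ∨ (adjacent a a′ ∧ (b ≡ᵇ b′))) ∧ q a′ b′ ⟧))
    ≡⟨ ∑<-cong n (λ a′ → ∑<-cong m (λ b′ → split a′ b′)) ⟩
  ∑< n (λ a′ → ∑< m (λ b′ → horizontal a′ b′ + vertical a′ b′))
    ≡⟨ ∑<-cong n (λ a′ → ∑<-+ m (horizontal a′) (vertical a′)) ⟩
  ∑< n (λ a′ → ∑< m (horizontal a′) + ∑< m (vertical a′))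
    ≡⟨ ∑<-+ n _ _ ⟩
  ∑< n (λ a′ → ∑< m (horizontal a′)) + ∑< n (λ a′ → ∑< m (vertical a′))
    ≡⟨ cong₂ _+_ horizontal-sum vertical-sum ⟩
  gridCount n m a b q ∎
  where
  open ≡-Reasoning
  a = toℕ i
  b = toℕ j
  adjacent : ℕ → ℕ → Bool
  adjacent x y = (suc x ≡ᵇ y) ∨ (suc y ≡ᵇ x)
  horizontal vertical : ℕ → ℕ → ℕ
  horizontal a′ b′ = ⟦ a ≡ᵇ a′ ⟧ * ((⟦ suc b ≡ᵇ b′ ⟧ + ⟦ suc b′ ≡ᵇ b ⟧) * ⟦ q a′ b′ ⟧)
  vertical a′ b′ = (⟦ suc a ≡ᵇ a′ ⟧ + ⟦ suc a′ ≡ᵇ a ⟧) * (⟦ b ≡ᵇ b′ ⟧ * ⟦ q a′ b′ ⟧)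
  split : ∀ a′ b′ → ⟦ (((a ≡ᵇ a′) ∧ adjacent b b′) ∨ (adjacent a a′ ∧ (b ≡ᵇ b′))) ∧ q a′ b′ ⟧ ≡ horizontal a′ b′ + vertical a′ b′
  split a′ b′ rewrite ⟦∧∨∧⟧ (a ≡ᵇ a′) (adjacent b b′) (adjacent a a′) (b ≡ᵇ b′) (q a′ b′) (≡ᵇ∧adjacent≡false a a′)
    | ⟦adjacent⟧ b b′ | ⟦adjacent⟧ a a′ = refl
  horizontal-sum : ∑< n (λ a′ → ∑< m (horizontal a′)) ≡ pathCount m b (q a)
  horizontal-sum = begin
    ∑< n (λ a′ → ∑< m (horizontal a′))
      ≡⟨ ∑<-cong n (λ a′ → trans (∑<-* m ⟦ a ≡ᵇ a′ ⟧ _) (cong (⟦ a ≡ᵇ a′ ⟧ *_) (∑<-path (q a′) (toℕ<n j)))) ⟩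
    ∑< n (λ a′ → ⟦ a ≡ᵇ a′ ⟧ * pathCount m b (q a′))
      ≡⟨ ∑<-δ-at (λ a′ → pathCount m b (q a′)) (toℕ<n i) ⟩
    pathCount m b (q a) ∎
  vertical-sum : ∑< n (λ a′ → ∑< m (vertical a′)) ≡ pathCount n a (λ a′ → q a′ b)
  vertical-sum = begin
    ∑< n (λ a′ → ∑< m (vertical a′))
      ≡⟨ ∑<-cong n (λ a′ → trans (∑<-* m (⟦ suc a ≡ᵇ a′ ⟧ + ⟦ suc a′ ≡ᵇ a ⟧) _)
           (cong ((⟦ suc a ≡ᵇ a′ ⟧ + ⟦ suc a′ ≡ᵇ a ⟧) *_) (∑<-δ-at (⟦_⟧ ∘ q a′) (toℕ<n j)))) ⟩
    ∑< n (λ a′ → (⟦ suc a ≡ᵇ a′ ⟧ + ⟦ suc a′ ≡ᵇ a ⟧) * ⟦ q a′ b ⟧)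
      ≡⟨ ∑<-path (λ a′ → q a′ b) (toℕ<n i) ⟩
    pathCount n a (λ a′ → q a′ b) ∎

asℕ : ∀ {n m} → VSet (grid n m) → ℕ → ℕ → Bool
asℕ {n} {m} S a b with a <? n | b <? m
... | yes a<n | yes b<m = S (fromℕ< a<n , fromℕ< b<m)
... | _ | _ = false

asℕ-toℕ : ∀ {n m} (S : VSet (grid n m)) i j → asℕ S (toℕ i) (toℕ j) ≡ S (i , j)
asℕ-toℕ {n} {m} S i j with toℕ i <? n | toℕ j <? m
... | yes i<n | yes j<m = cong₂ (λ x y → S (x , y)) (fromℕ<-toℕ i i<n) (fromℕ<-toℕ j j<m)
... | no i≮n | _ = ⊥-elim (i≮n (toℕ<n i))
... | yes _ | no j≮m = ⊥-elim (j≮m (toℕ<n j))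

nbrsIn-grid : ∀ {n m} (S : VSet (grid n m)) i j →
  nbrsIn (grid n m) S (i , j) ≡ gridCount n m (toℕ i) (toℕ j) (asℕ S)
nbrsIn-grid {n} {m} S i j = trans (length-filterᵇ _ (verts (grid n m)))
  (trans (∑-cong (verts (grid n m)) (λ (i′ , j′) →
           cong (λ x → ⟦ adj (grid n m) (i , j) (i′ , j′) ∧ x ⟧) (sym (asℕ-toℕ S i′ j′))))
    (grid-count i j (asℕ S)))

≡ᵇ-sym : ∀ x y → (x ≡ᵇ y) ≡ (y ≡ᵇ x)
≡ᵇ-sym zero zero = refl
≡ᵇ-sym zero (suc y) = refl
≡ᵇ-sym (suc x) zero = refl
≡ᵇ-sym (suc x) (suc y) = ≡ᵇ-sym x y

grid-sym : ∀ n m u v → adj (grid n m) u v ≡ adj (grid n m) v u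
grid-sym n m (i , j) (i′ , j′) rewrite ≡ᵇ-sym (toℕ i) (toℕ i′) | ≡ᵇ-sym (toℕ j) (toℕ j′)
  | ∨-comm (suc (toℕ j) ≡ᵇ toℕ j′) (suc (toℕ j′) ≡ᵇ toℕ j)
  | ∨-comm (suc (toℕ i) ≡ᵇ toℕ i′) (suc (toℕ i′) ≡ᵇ toℕ i) = refl

grid-complete : ∀ {n m} (v : V (grid n m)) → v ∈ verts (grid n m)
grid-complete (i , j) = ∈-cartesianProduct⁺ (∈-allFin i) (∈-allFin j)

grid-≟ : ∀ {n m} → DecidableEquality (V (grid n m))
grid-≟ = ≡-dec Fin._≟_ Fin._≟_

length-grid : ∀ n m → length (verts (grid n m)) ≡ n * m
length-grid n m = begin
  length (verts (grid n m))          ≡⟨ ∑-1 (verts (grid n m)) ⟨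
  ∑ (verts (grid n m)) (λ _ → 1)     ≡⟨ ∑-grid n m (λ _ _ → 1) ⟩
  ∑< n (λ _ → ∑< m (λ _ → 1))        ≡⟨ ∑<-cong n (λ _ → trans (∑<-const m 1) (*-identityʳ m)) ⟩
  ∑< n (λ _ → m)                     ≡⟨ ∑<-const n m ⟩
  n * m                              ∎
  where open ≡-Reasoning

∑<-pathCount-all : ∀ m → ∑< (suc m) (λ b → pathCount (suc m) b (λ _ → true)) ≡ 2 * m
∑<-pathCount-all m = begin
  ∑< (suc m) (λ b → ⟦ b <ᵇ m ⟧ * 1 + atPred b (λ _ → 1))
    ≡⟨ ∑<-+ (suc m) (λ b → ⟦ b <ᵇ m ⟧ * 1) (λ b → atPred b (λ _ → 1)) ⟩
  ∑< (suc m) (λ b → ⟦ b <ᵇ m ⟧ * 1) + ∑< m (λ _ → 1)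
    ≡⟨ cong₂ _+_ (trans (∑<-cong (suc m) (λ b → *-identityʳ ⟦ b <ᵇ m ⟧)) (∑<-<ᵇ m))
                 (trans (∑<-const m 1) (*-identityʳ m)) ⟩
  m + m
    ≡⟨ cong (m +_) (+-identityʳ m) ⟨
  2 * m ∎
  where open ≡-Reasoning

degreeSum-grid : ∀ n m → degreeSum (grid (suc n) (suc m)) (λ _ → true) ≡ suc n * (2 * m) + suc m * (2 * n)
degreeSum-grid n m = begin
  degreeSum G (λ _ → true)
    ≡⟨ ∑-cong (verts G) (λ (i , j) → trans (+-identityʳ _) (trans (length-filterᵇ _ (verts G)) (grid-count i j (λ _ → full)))) ⟩
  ∑ (verts G) (λ (i , j) → gridCount (suc n) (suc m) (toℕ i) (toℕ j) (λ _ → full))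
    ≡⟨ ∑-grid (suc n) (suc m) (λ a b → gridCount (suc n) (suc m) a b (λ _ → full)) ⟩
  ∑< (suc n) (λ a → ∑< (suc m) (λ b → pathCount (suc m) b full + pathCount (suc n) a full))
    ≡⟨ ∑<-cong (suc n) (λ a → trans (∑<-+ (suc m) (λ b → pathCount (suc m) b full) (λ _ → pathCount (suc n) a full))
                                    (cong₂ _+_ (∑<-pathCount-all m) (∑<-const (suc m) (pathCount (suc n) a full)))) ⟩
  ∑< (suc n) (λ a → 2 * m + suc m * pathCount (suc n) a full)
    ≡⟨ ∑<-+ (suc n) (λ _ → 2 * m) (λ a → suc m * pathCount (suc n) a full) ⟩
  ∑< (suc n) (λ _ → 2 * m) + ∑< (suc n) (λ a → suc m * pathCount (suc n) a full)
    ≡⟨ cong₂ _+_ (∑<-const (suc n) (2 * m))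
                 (trans (∑<-* (suc n) (suc m) (λ a → pathCount (suc n) a full)) (cong (suc m *_) (∑<-pathCount-all n))) ⟩
  suc n * (2 * m) + suc m * (2 * n) ∎
  where
  open ≡-Reasoning
  G = grid (suc n) (suc m)
  full : ℕ → Bool
  full _ = true

-- Lower bound for P₄ □ Pₘ

atPred-⟦⟧≤1 : ∀ b (q : ℕ → Bool) → atPred b (⟦_⟧ ∘ q) ≤ 1
atPred-⟦⟧≤1 zero q = z≤n
atPred-⟦⟧≤1 (suc b) q = ⟦⟧≤1 (q b)

pathCount-first : ∀ m q → pathCount m 0 q ≤ 1
pathCount-first m q = ≤-trans (≤-reflexive (+-identityʳ _)) (⟦⟧*⟦⟧≤1 (1 <ᵇ m) (q 1))

pathCount-last : ∀ b q → pathCount (suc b) b q ≤ 1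
pathCount-last b q rewrite ≮⇒⟦<ᵇ⟧≡0 {b} {b} (<-irrefl refl) = atPred-⟦⟧≤1 b q

pathCount-without-suc : ∀ m b q → q (suc b) ≡ false → pathCount m b q ≤ 1
pathCount-without-suc m b q qb rewrite qb | *-zeroʳ ⟦ suc b <ᵇ m ⟧ = atPred-⟦⟧≤1 b q

pathCount-without-pred : ∀ m b q → q b ≡ false → pathCount m (suc b) q ≤ 1
pathCount-without-pred m b q qb rewrite qb = ≤-trans (≤-reflexive (+-identityʳ _)) (⟦⟧*⟦⟧≤1 (suc (suc b) <ᵇ m) (q (suc (suc b))))

row₀ row₁ row₂ row₃ : Fin 4
row₀ = Fin.zero
row₁ = Fin.suc Fin.zero
row₂ = Fin.suc (Fin.suc Fin.zero)
row₃ = Fin.suc (Fin.suc (Fin.suc Fin.zero))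

module _ {m : ℕ} (A : VSet (grid 4 m)) (P : Percolating (grid 4 m) 3 A) (j : Fin m) (end : ∀ q → pathCount m (toℕ j) q ≤ 1) where

  private
    column : VSet (grid 4 m) → ℕ → Bool
    column S a = asℕ S a (toℕ j)

    few : ∀ (S : VSet (grid 4 m)) i → pathCount 4 (toℕ i) (column S) ≤ 1 → nbrsIn (grid 4 m) S (i , j) < 3
    few S i vertical = subst (_< 3) (sym (nbrsIn-grid S i j)) (s≤s (+-mono-≤ (end (asℕ S (toℕ i))) vertical))

    without : ∀ (S : VSet (grid 4 m)) i → S (i , j) ≡ false → asℕ S (toℕ i) (toℕ j) ≡ false
    without S i Si = trans (asℕ-toℕ S i j) Si

  end-column-seeds : A (row₀ , j) ≡ true × A (row₃ , j) ≡ true × A (row₁ , j) ∨ A (row₂ , j) ≡ true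
  end-column-seeds =
    must-be-seed (grid 4 m) 3 P (λ S _ → few S row₀ (pathCount-first 4 (column S))) ,
    must-be-seed (grid 4 m) 3 P (λ S _ → few S row₃ (pathCount-last 3 (column S))) ,
    pair-contains-seed (grid 4 m) 3 P (λ S S₂ → few S row₁ (pathCount-without-suc 4 1 (column S) (without S row₂ S₂)))
                             (λ S S₁ → few S row₂ (pathCount-without-pred 4 1 (column S) (without S row₁ S₁)))

column-degreeSum : ∀ (f : ℕ → Bool) → f 0 ≡ true → f 3 ≡ true → f 1 ∨ f 2 ≡ true →
  2 ≤ ∑< 4 (λ a → ⟦ f a ⟧ * pathCount 4 a f)
column-degreeSum f f₀ f₃ f₁₂ with f 0 | f 3 | f 1 | f 2 | f₀ | f₃ | f₁₂
... | true | true | true | true | _ | _ | _ = s≤s (s≤s z≤n)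
... | true | true | true | false | _ | _ | _ = s≤s (s≤s z≤n)
... | true | true | false | true | _ | _ | _ = s≤s (s≤s z≤n)

module _ {k : ℕ} (A : VSet (grid 4 (suc (suc k)))) (P : Percolating (grid 4 (suc (suc k))) 3 A) where

  private
    m = suc (suc k)
    vertical : ℕ → ℕ → ℕ
    vertical a b = ⟦ asℕ A a b ⟧ * pathCount 4 a (λ a′ → asℕ A a′ b)

    column-edge : ∀ j → (∀ q → pathCount m (toℕ j) q ≤ 1) → 2 ≤ ∑< 4 (λ a → vertical a (toℕ j))
    column-edge j end with end-column-seeds A P j end
    ... | s₀ , s₃ , s₁₂ = column-degreeSum (λ a → asℕ A a (toℕ j))
      (trans (asℕ-toℕ A row₀ j) s₀) (trans (asℕ-toℕ A row₃ j) s₃)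
      (trans (cong₂ _∨_ (asℕ-toℕ A row₁ j) (asℕ-toℕ A row₂ j)) s₁₂)

    last-column-edge : 2 ≤ ∑< 4 (λ a → vertical a (suc k))
    last-column-edge = subst (λ b → 2 ≤ ∑< 4 (λ a → vertical a b)) (toℕ-fromℕ (suc k))
      (column-edge (fromℕ (suc k)) (λ q →
        subst (λ b → pathCount m b q ≤ 1) (sym (toℕ-fromℕ (suc k))) (pathCount-last (suc k) q)))

  4≤degreeSum : 4 ≤ degreeSum (grid 4 m) A
  4≤degreeSum = begin
    4
      ≤⟨ +-mono-≤ (column-edge Fin.zero (pathCount-first m)) last-column-edge ⟩
    ∑< 4 (λ a → vertical a 0) + ∑< 4 (λ a → vertical a (suc k))
      ≡⟨ ∑<-+ 4 (λ a → vertical a 0) (λ a → vertical a (suc k)) ⟨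
    ∑< 4 (λ a → vertical a 0 + vertical a (suc k))
      ≤⟨ ∑<-mono 4 (λ a → ≤-trans (+-mono-≤ (vertical≤ a 0) (vertical≤ a (suc k))) (∑<-ends k (term a))) ⟩
    ∑< 4 (λ a → ∑< m (term a))
      ≡⟨ ∑-grid 4 m term ⟨
    ∑ (verts (grid 4 m)) (λ (i , j) → term (toℕ i) (toℕ j))
      ≡⟨ ∑-cong (verts (grid 4 m)) (λ (i , j) → cong₂ (λ x y → ⟦ x ⟧ * y) (asℕ-toℕ A i j) (sym (nbrsIn-grid A i j))) ⟩
    degreeSum (grid 4 m) A ∎
    where
    open ≤-Reasoning
    term : ℕ → ℕ → ℕ
    term a b = ⟦ asℕ A a b ⟧ * gridCount 4 m a b (asℕ A)
    vertical≤ : ∀ a b → vertical a b ≤ term a b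
    vertical≤ a b = *-monoʳ-≤ ⟦ asℕ A a b ⟧ (m≤n+m _ (pathCount m b (asℕ A a)))

  percolating-grid-size : 5 * m + 6 ≤ 3 * size (grid 4 m) A
  percolating-grid-size = *-cancelˡ-≤ 2 (+-cancelʳ-≤ D _ _ (begin
    2 * (5 * m + 6) + D                           ≡⟨ arith₁ k ⟩
    4 + 2 * 3 * (4 * m)                           ≤⟨ +-monoˡ-≤ _ 4≤degreeSum ⟩
    degreeSum G A + 2 * 3 * (4 * m)               ≡⟨ cong (λ n → degreeSum G A + 2 * 3 * n) (length-grid 4 m) ⟨
    degreeSum G A + 2 * 3 * length (verts G)      ≤⟨ percolating-degreeSum (grid-sym 4 m) grid-complete 3 A P ⟩
    degreeSum G (λ _ → true) + 2 * 3 * size G A   ≡⟨ cong (_+ 2 * 3 * size G A) (degreeSum-grid 3 (suc k)) ⟩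
    D + 2 * 3 * size G A                          ≡⟨ arith₂ D (size G A) ⟩
    2 * (3 * size G A) + D                        ∎))
    where
    open ≤-Reasoning
    G = grid 4 m
    D = 4 * (2 * suc k) + m * (2 * 3)
    arith₁ : ∀ k → 2 * (5 * suc (suc k) + 6) + (4 * (2 * suc k) + suc (suc k) * (2 * 3)) ≡ 4 + 2 * 3 * (4 * suc (suc k))
    arith₁ = solve-∀
    arith₂ : ∀ d s → d + 2 * 3 * s ≡ 2 * (3 * s) + d
    arith₂ = solve-∀

lower-bound : ∀ m → 2 ≤ m → ∀ A → Percolating (grid 4 m) 3 A → 5 * (m + 1) / 3 + 1 ≤ size (grid 4 m) A
lower-bound m@(suc (suc k)) _ A P = subst (_≤ size (grid 4 m) A) (+-comm 1 _) (m<n*o⇒m/o<n (begin-strict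
  5 * (m + 1)              ≡⟨ arith k ⟩
  5 * m + 5                <⟨ +-monoʳ-< (5 * m) (n<1+n 5) ⟩
  5 * m + 6                ≤⟨ percolating-grid-size A P ⟩
  3 * size (grid 4 m) A    ≡⟨ *-comm 3 (size (grid 4 m) A) ⟩
  size (grid 4 m) A * 3    ∎))
  where
  open ≤-Reasoning
  arith : ∀ k → 5 * (suc (suc k) + 1) ≡ 5 * suc (suc k) + 5
  arith = solve-∀
lower-bound (suc zero) (s≤s ())

-- Certificates and upper bound for P₄ □ Pₘ

-- A certificate for the 4 × m grid lists its columns, each giving the infection times of its four rows (0 for
-- the seeds).  Rows a ≥ 4 and columns beyond the list read as time 0; they never occur.
data Column : Set where
  col : ℕ → ℕ → ℕ → ℕ → Column

get : Column → ℕ → ℕ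
get (col x₀ x₁ x₂ x₃) 0 = x₀
get (col x₀ x₁ x₂ x₃) 1 = x₁
get (col x₀ x₁ x₂ x₃) 2 = x₂
get (col x₀ x₁ x₂ x₃) 3 = x₃
get (col x₀ x₁ x₂ x₃) _ = 0

earlier : Maybe Column → ℕ → ℕ → ℕ
earlier nothing a t = 0
earlier (just c) a t = ⟦ get c a <ᵇ t ⟧

readyCount : Maybe Column → Column → Maybe Column → ℕ → ℕ → ℕ
readyCount prev c next a t = (earlier next a t + earlier prev a t) + pathCount 4 a (λ a′ → get c a′ <ᵇ t)

ready : Maybe Column → Column → Maybe Column → ℕ → Bool
ready prev c next a = (get c a ≡ᵇ 0) ∨ (3 ≤ᵇ readyCount prev c next a (get c a))

columnOK : Maybe Column → Maybe Column → Maybe Column → Bool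
columnOK prev nothing next = true
columnOK prev (just c) next = ready prev c next 0 ∧ (ready prev c next 1 ∧ (ready prev c next 2 ∧ ready prev c next 3))

check : Maybe Column → List Column → Bool
check prev [] = true
check prev (c ∷ cs) = columnOK prev (just c) (head cs) ∧ check (just c) cs

columnAt : List Column → ℕ → Maybe Column
columnAt cs b = head (drop b cs)

previous : Maybe Column → List Column → ℕ → Maybe Column
previous prev cs zero = prev
previous prev cs (suc b) = columnAt cs b

time : List Column → ℕ → ℕ → ℕ
time cs a b = maybe (λ c → get c a) 0 (columnAt cs b)

schedule : (cs : List Column) → V (grid 4 (length cs)) → ℕ
schedule cs (i , j) = time cs (toℕ i) (toℕ j)

check-columnAt : ∀ prev cs b → check prev cs ≡ true →
  columnOK (previous prev cs b) (columnAt cs b) (columnAt cs (suc b)) ≡ true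
check-columnAt prev [] zero _ = refl
check-columnAt prev [] (suc b) _ = refl
check-columnAt prev (c ∷ cs) zero ok = ∧-conicalˡ _ _ ok
check-columnAt prev (c ∷ cs) (suc zero) ok = check-columnAt (just c) cs zero (∧-conicalʳ _ _ ok)
check-columnAt prev (c ∷ cs) (suc (suc b)) ok = check-columnAt (just c) cs (suc b) (∧-conicalʳ _ _ ok)

columnOK-ready : ∀ prev c next (i : Fin 4) → columnOK prev (just c) next ≡ true → ready prev c next (toℕ i) ≡ true
columnOK-ready prev c next i ok =
  row i (∧-conicalˡ (R 0) _ ok) (∧-conicalˡ (R 1) _ ok₁) (∧-conicalˡ (R 2) (R 3) ok₂) (∧-conicalʳ (R 2) (R 3) ok₂)
  where
  R = ready prev c next
  ok₁ = ∧-conicalʳ (R 0) _ ok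
  ok₂ = ∧-conicalʳ (R 1) _ ok₁
  row : ∀ (i : Fin 4) → R 0 ≡ true → R 1 ≡ true → R 2 ≡ true → R 3 ≡ true → R (toℕ i) ≡ true
  row Fin.zero r₀ r₁ r₂ r₃ = r₀
  row (Fin.suc Fin.zero) r₀ r₁ r₂ r₃ = r₁
  row (Fin.suc (Fin.suc Fin.zero)) r₀ r₁ r₂ r₃ = r₂
  row (Fin.suc (Fin.suc (Fin.suc Fin.zero))) r₀ r₁ r₂ r₃ = r₃

columnAt-just : ∀ cs b → b < length cs → ∃ λ c → columnAt cs b ≡ just c
columnAt-just (c ∷ cs) zero _ = c , refl
columnAt-just (c ∷ cs) (suc b) (s≤s b<n) = columnAt-just cs b b<n

earlier-next : ∀ cs x a t → ⟦ x <ᵇ length cs ⟧ * ⟦ time cs a x <ᵇ t ⟧ ≡ earlier (columnAt cs x) a t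
earlier-next [] zero a t = refl
earlier-next [] (suc x) a t = refl
earlier-next (c ∷ cs) zero a t = +-identityʳ _
earlier-next (c ∷ cs) (suc x) a t = earlier-next cs x a t

earlier-previous : ∀ cs b a t → b < length cs →
  atPred b (λ b′ → ⟦ time cs a b′ <ᵇ t ⟧) ≡ earlier (previous nothing cs b) a t
earlier-previous cs zero a t _ = refl
earlier-previous cs (suc b) a t b<n = trans (sym (*-identityˡ _))
  (trans (cong (_* ⟦ time cs a b <ᵇ t ⟧) (sym (<⇒⟦<ᵇ⟧≡1 (<-trans (n<1+n b) b<n)))) (earlier-next cs b a t))

gridCount-certificate : ∀ cs a b c t → b < length cs → columnAt cs b ≡ just c →
  gridCount 4 (length cs) a b (λ a′ b′ → time cs a′ b′ <ᵇ t) ≡ readyCount (previous nothing cs b) c (columnAt cs (suc b)) a t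
gridCount-certificate cs a b c t b<n at-b =
  cong₂ _+_ (cong₂ _+_ (earlier-next cs (suc b) a t) (earlier-previous cs b a t b<n)) vertical
  where
  vertical : pathCount 4 a (λ a′ → time cs a′ b <ᵇ t) ≡ pathCount 4 a (λ a′ → get c a′ <ᵇ t)
  vertical rewrite at-b = refl

certificate-schedule : ∀ cs → check nothing cs ≡ true → IsSchedule (grid 4 (length cs)) 3 (schedule cs)
certificate-schedule cs ok (i , j) 0<t with columnAt-just cs (toℕ j) (toℕ<n j)
... | c , at-j = begin
  3                                                                  ≤⟨ ≤ᵇ≡true⇒≤ ready-by-count ⟩
  readyCount prev c next a t                                         ≡⟨ gridCount-certificate cs a b c t (toℕ<n j) at-j ⟨
  gridCount 4 (length cs) a b (λ a′ b′ → time cs a′ b′ <ᵇ t)          ≡⟨ grid-count i j (λ a′ b′ → time cs a′ b′ <ᵇ t) ⟨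
  ∑ (verts G) (λ u → ⟦ adj G (i , j) u ∧ (schedule cs u <ᵇ t) ⟧)     ≡⟨ length-filterᵇ _ (verts G) ⟨
  nbrsIn G (λ u → schedule cs u <ᵇ t) (i , j)                        ∎
  where
  open ≤-Reasoning
  G = grid 4 (length cs)
  a = toℕ i
  b = toℕ j
  prev = previous nothing cs b
  next = columnAt cs (suc b)
  t = schedule cs (i , j)
  t≡get : t ≡ get c a
  t≡get rewrite at-j = refl
  is-ready : ready prev c next a ≡ true
  is-ready = columnOK-ready prev c next i (subst (λ x → columnOK prev x next ≡ true) at-j (check-columnAt nothing cs b ok))
  ready-by-count : (3 ≤ᵇ readyCount prev c next a t) ≡ true
  ready-by-count = subst (λ x → (3 ≤ᵇ readyCount prev c next a x) ≡ true) (sym t≡get)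
    (resolve (nonzero (subst (0 <_) t≡get 0<t)) is-ready)
    where
    nonzero : ∀ {n} → 0 < n → (n ≡ᵇ 0) ≡ false
    nonzero (s≤s _) = refl
    resolve : ∀ {x y} → x ≡ false → x ∨ y ≡ true → y ≡ true
    resolve refl e = e

columnSeeds : Column → ℕ
columnSeeds c = ∑< 4 (λ a → ⟦ get c a ≡ᵇ 0 ⟧)

seedCount : List Column → ℕ
seedCount cs = ∑ cs columnSeeds

∑<-columnAt : ∀ cs (g : Maybe Column → ℕ) → ∑< (length cs) (λ b → g (columnAt cs b)) ≡ ∑ cs (g ∘ just)
∑<-columnAt [] g = refl
∑<-columnAt (c ∷ cs) g = cong (g (just c) +_) (∑<-columnAt cs g)

size-certificate : ∀ cs → size (grid 4 (length cs)) (λ v → schedule cs v ≡ᵇ 0) ≡ seedCount cs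
size-certificate cs = begin
  size (grid 4 m) (λ v → schedule cs v ≡ᵇ 0)            ≡⟨ length-filterᵇ _ (verts (grid 4 m)) ⟩
  ∑ (verts (grid 4 m)) (λ v → ⟦ schedule cs v ≡ᵇ 0 ⟧)   ≡⟨ ∑-grid 4 m (λ a b → ⟦ time cs a b ≡ᵇ 0 ⟧) ⟩
  ∑< 4 (λ a → ∑< m (λ b → ⟦ time cs a b ≡ᵇ 0 ⟧))        ≡⟨ ∑<-cong 4 (λ a → ∑<-columnAt cs (λ c → ⟦ maybe (λ c → get c a) 0 c ≡ᵇ 0 ⟧)) ⟩
  ∑< 4 (λ a → ∑ cs (λ c → ⟦ get c a ≡ᵇ 0 ⟧))            ≡⟨ ∑<-∑-comm 4 cs (λ a c → ⟦ get c a ≡ᵇ 0 ⟧) ⟩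
  seedCount cs                                          ∎
  where
  open ≡-Reasoning
  m = length cs

certificate-percolates : ∀ cs → check nothing cs ≡ true → PercolationNumber≤ (grid 4 (length cs)) 3 (seedCount cs)
certificate-percolates cs ok = _ , schedule-percolates _ 3 (certificate-schedule cs ok) , ≤-reflexive (size-certificate cs)

certified : ∀ cs {m B} → length cs ≡ m → check nothing cs ≡ true → seedCount cs ≤ B → PercolationNumber≤ (grid 4 m) 3 B
certified cs refl ok small with certificate-percolates cs ok
... | A , P , size≤ = A , P , ≤-trans size≤ small

smallCertificate : ℕ → List Column
smallCertificate 0 = col 0 0 1 0 ∷ col 0 1 0 1 ∷ col 0 2 3 0 ∷ col 0 0 4 0 ∷ []
smallCertificate 1 = col 0 0 1 0 ∷ col 0 1 0 1 ∷ col 0 2 3 0 ∷ col 1 0 4 5 ∷ col 0 1 0 0 ∷ []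
smallCertificate 2 = col 0 0 1 0 ∷ col 0 1 0 1 ∷ col 1 0 1 0 ∷ col 0 1 2 0 ∷ col 1 0 3 4 ∷ col 0 1 0 0 ∷ []
smallCertificate 3 = col 0 0 1 0 ∷ col 4 3 0 1 ∷ col 0 2 1 0 ∷ col 1 0 0 1 ∷ col 0 1 2 0 ∷ col 1 0 3 4 ∷ col 0 1 0 0 ∷ []
smallCertificate 4 = col 0 1 0 0 ∷ col 1 0 1 0 ∷ col 0 1 2 3 ∷ col 1 0 1 0 ∷ col 0 1 0 1 ∷ col 0 2 3 0 ∷ col 1 0 4 5 ∷ col 0 1 0 0 ∷ []
smallCertificate 5 = col 0 1 0 0 ∷ col 1 0 1 0 ∷ col 0 1 2 3 ∷ col 1 0 1 0 ∷ col 0 1 0 1 ∷ col 4 3 2 0 ∷ col 0 0 1 0 ∷ col 2 1 0 1 ∷ col 0 0 1 0 ∷ []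
smallCertificate 6 = col 0 1 0 0 ∷ col 1 0 1 0 ∷ col 0 1 2 3 ∷ col 1 0 1 0 ∷ col 0 1 0 1 ∷ col 5 4 1 0 ∷ col 0 3 0 1 ∷ col 0 2 1 0 ∷ col 0 1 0 1 ∷ col 0 0 1 0 ∷ []
smallCertificate 7 = col 0 1 0 0 ∷ col 1 0 1 0 ∷ col 0 1 2 3 ∷ col 1 0 1 0 ∷ col 0 1 0 1 ∷ col 3 2 1 0 ∷ col 0 1 0 1 ∷ col 1 0 1 0 ∷ col 0 1 2 0 ∷ col 1 0 3 4 ∷ col 0 1 0 0 ∷ []
smallCertificate 8 = col 0 1 0 0 ∷ col 1 0 1 0 ∷ col 0 1 2 3 ∷ col 1 0 1 0 ∷ col 0 1 0 1 ∷ col 3 2 1 0 ∷ col 0 1 0 1 ∷ col 1 0 1 0 ∷ col 0 1 2 3 ∷ col 0 0 1 0 ∷ col 2 1 0 1 ∷ col 0 0 1 0 ∷ []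
smallCertificate 9 = col 0 1 0 0 ∷ col 1 0 1 0 ∷ col 0 1 2 3 ∷ col 1 0 1 0 ∷ col 0 1 0 1 ∷ col 3 2 1 0 ∷ col 0 1 0 1 ∷ col 1 0 1 0 ∷ col 0 1 2 3 ∷ col 1 0 1 0 ∷ col 0 1 0 1 ∷ col 0 2 3 0 ∷ col 0 0 4 0 ∷ []
smallCertificate 10 = col 0 1 0 0 ∷ col 1 0 1 0 ∷ col 0 1 2 3 ∷ col 1 0 1 0 ∷ col 0 1 0 1 ∷ col 3 2 1 0 ∷ col 0 1 0 1 ∷ col 1 0 1 0 ∷ col 0 1 2 3 ∷ col 1 0 1 0 ∷ col 0 1 0 1 ∷ col 0 2 3 0 ∷ col 1 0 4 5 ∷ col 0 1 0 0 ∷ []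
smallCertificate 11 = col 0 1 0 0 ∷ col 1 0 1 0 ∷ col 0 1 2 3 ∷ col 1 0 1 0 ∷ col 0 1 0 1 ∷ col 3 2 1 0 ∷ col 0 1 0 1 ∷ col 1 0 1 0 ∷ col 0 1 2 3 ∷ col 1 0 1 0 ∷ col 0 1 0 1 ∷ col 4 3 2 0 ∷ col 0 0 1 0 ∷ col 2 1 0 1 ∷ col 0 0 1 0 ∷ []
smallCertificate _ = []

periodicHead : List Column
periodicHead = col 0 1 0 0 ∷ col 1 0 1 0 ∷ col 0 1 2 3 ∷ col 1 0 1 0 ∷ col 0 1 0 1 ∷ col 3 2 1 0 ∷ []

period : List Column
period = col 0 1 0 1 ∷ col 1 0 1 0 ∷ col 0 1 2 3 ∷ col 1 0 1 0 ∷ col 0 1 0 1 ∷ col 3 2 1 0 ∷ []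

periodicTail : ℕ → List Column
periodicTail 0 = col 0 1 0 1 ∷ col 1 0 1 0 ∷ col 0 1 2 3 ∷ col 1 0 1 0 ∷ col 0 1 0 1 ∷ col 5 4 1 0 ∷ col 0 3 0 1 ∷ col 0 2 1 0 ∷ col 0 1 0 1 ∷ col 0 0 1 0 ∷ []
periodicTail 1 = col 0 1 0 1 ∷ col 1 0 1 0 ∷ col 0 1 2 3 ∷ col 1 0 1 0 ∷ col 0 1 0 1 ∷ col 3 2 1 0 ∷ col 0 1 0 1 ∷ col 1 0 1 0 ∷ col 0 1 2 0 ∷ col 1 0 3 4 ∷ col 0 1 0 0 ∷ []
periodicTail 2 = col 0 1 0 1 ∷ col 1 0 1 0 ∷ col 0 1 2 3 ∷ col 1 0 1 0 ∷ col 0 1 0 1 ∷ col 3 2 1 0 ∷ col 0 1 0 1 ∷ col 1 0 1 0 ∷ col 0 1 2 3 ∷ col 0 0 1 0 ∷ col 2 1 0 1 ∷ col 0 0 1 0 ∷ []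
periodicTail 3 = col 0 1 0 1 ∷ col 1 0 1 0 ∷ col 0 1 2 3 ∷ col 1 0 1 0 ∷ col 0 1 0 1 ∷ col 3 2 1 0 ∷ col 0 1 0 1 ∷ col 1 0 1 0 ∷ col 0 1 2 3 ∷ col 1 0 1 0 ∷ col 0 1 0 1 ∷ col 0 2 3 0 ∷ col 0 0 4 0 ∷ []
periodicTail 4 = col 0 1 0 1 ∷ col 1 0 1 0 ∷ col 0 1 2 3 ∷ col 1 0 1 0 ∷ col 0 1 0 1 ∷ col 3 2 1 0 ∷ col 0 1 0 1 ∷ col 1 0 1 0 ∷ col 0 1 2 3 ∷ col 1 0 1 0 ∷ col 0 1 0 1 ∷ col 0 2 3 0 ∷ col 1 0 4 5 ∷ col 0 1 0 0 ∷ []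
periodicTail 5 = col 0 1 0 1 ∷ col 1 0 1 0 ∷ col 0 1 2 3 ∷ col 1 0 1 0 ∷ col 0 1 0 1 ∷ col 3 2 1 0 ∷ col 0 1 0 1 ∷ col 1 0 1 0 ∷ col 0 1 2 3 ∷ col 1 0 1 0 ∷ col 0 1 0 1 ∷ col 4 3 2 0 ∷ col 0 0 1 0 ∷ col 2 1 0 1 ∷ col 0 0 1 0 ∷ []
periodicTail _ = []

periodic : ℕ → List Column → List Column
periodic zero tail = tail
periodic (suc p) tail = period ++ periodic p tail

lastColumn : Column
lastColumn = col 3 2 1 0

-- Both periodicHead and period end with lastColumn, and every periodic (suc p) tail starts like period,
-- so checking one more period reduces, by computation, to the already checked shorter list.
check-periodic : ∀ tail → check (just lastColumn) tail ≡ true → check (just lastColumn) (period ++ tail) ≡ true →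
  ∀ p → check (just lastColumn) (periodic p tail) ≡ true
check-periodic tail ok₀ ok₁ zero = ok₀
check-periodic tail ok₀ ok₁ (suc zero) = ok₁
check-periodic tail ok₀ ok₁ (suc (suc p)) = check-periodic tail ok₀ ok₁ (suc p)

check-periodicHead : ∀ tail → check (just lastColumn) tail ≡ true → check (just lastColumn) (period ++ tail) ≡ true →
  check nothing (periodicHead ++ tail) ≡ true → ∀ p → check nothing (periodicHead ++ periodic p tail) ≡ true
check-periodicHead tail ok₀ ok₁ ok-head zero = ok-head
check-periodicHead tail ok₀ ok₁ ok-head (suc p) = check-periodic tail ok₀ ok₁ (suc p)

-- periodicHead ++ periodic p (periodicTail r) has 16 + r + 6p columns and 11 + 10p + seedCount (periodicTail r)
-- seeds; as 10/6 = 5/3, the bound ⌊5(m + 1)/3⌋ + 2 then holds for every p once it holds for p = 0 (few-seeds).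
record GoodTail (r : ℕ) : Set where
  field
    length≡ : length (periodicTail r) ≡ 10 + r
    tail-ok : check (just lastColumn) (periodicTail r) ≡ true
    period-ok : check (just lastColumn) (period ++ periodicTail r) ≡ true
    head-ok : check nothing (periodicHead ++ periodicTail r) ≡ true
    few-seeds : 3 * (9 + seedCount (periodicTail r)) ≤ 85 + 5 * r

good-tail : ∀ r → r < 6 → GoodTail r
good-tail 0 _ = record { length≡ = refl ; tail-ok = refl ; period-ok = refl ; head-ok = refl ; few-seeds = ≤ᵇ≡true⇒≤ refl }
good-tail 1 _ = record { length≡ = refl ; tail-ok = refl ; period-ok = refl ; head-ok = refl ; few-seeds = ≤ᵇ≡true⇒≤ refl }
good-tail 2 _ = record { length≡ = refl ; tail-ok = refl ; period-ok = refl ; head-ok = refl ; few-seeds = ≤ᵇ≡true⇒≤ refl }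
good-tail 3 _ = record { length≡ = refl ; tail-ok = refl ; period-ok = refl ; head-ok = refl ; few-seeds = ≤ᵇ≡true⇒≤ refl }
good-tail 4 _ = record { length≡ = refl ; tail-ok = refl ; period-ok = refl ; head-ok = refl ; few-seeds = ≤ᵇ≡true⇒≤ refl }
good-tail 5 _ = record { length≡ = refl ; tail-ok = refl ; period-ok = refl ; head-ok = refl ; few-seeds = ≤ᵇ≡true⇒≤ refl }
good-tail (suc (suc (suc (suc (suc (suc r)))))) (s≤s (s≤s (s≤s (s≤s (s≤s (s≤s ()))))))

length-periodic : ∀ p tail → length (periodic p tail) ≡ p * 6 + length tail
length-periodic zero tail = refl
length-periodic (suc p) tail = trans (length-++ period {periodic p tail})
  (trans (cong (6 +_) (length-periodic p tail)) (sym (+-assoc 6 (p * 6) _)))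

seedCount-periodic : ∀ p tail → seedCount (periodic p tail) ≡ p * 10 + seedCount tail
seedCount-periodic zero tail = refl
seedCount-periodic (suc p) tail = trans (∑-++ period (periodic p tail) columnSeeds)
  (trans (cong (10 +_) (seedCount-periodic p tail)) (sym (+-assoc 10 (p * 10) _)))

≤-/3 : ∀ {d n} → 3 * d ≤ n → d ≤ n / 3
≤-/3 {d} {n} 3d≤n = ≤-trans (≤-reflexive (sym (m*n/n≡m d 3))) (/-monoˡ-≤ 3 (subst (_≤ n) (*-comm 3 d) 3d≤n))

periodic-upper-bound : ∀ r p → r < 6 → PercolationNumber≤ (grid 4 (16 + (r + p * 6))) 3 (5 * (16 + (r + p * 6) + 1) / 3 + 2)
periodic-upper-bound r p r<6 = certified (periodicHead ++ periodic p tail) length≡′ checks seeds≤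
  where
  open GoodTail (good-tail r r<6)
  tail = periodicTail r
  length≡′ : length (periodicHead ++ periodic p tail) ≡ 16 + (r + p * 6)
  length≡′ = trans (length-++ periodicHead {periodic p tail})
    (trans (cong (6 +_) (trans (length-periodic p tail) (cong (p * 6 +_) length≡))) (arith r p))
    where
    arith : ∀ r p → 6 + (p * 6 + (10 + r)) ≡ 16 + (r + p * 6)
    arith = solve-∀
  checks : check nothing (periodicHead ++ periodic p tail) ≡ true
  checks = check-periodicHead tail tail-ok period-ok head-ok p
  seeds≤ : seedCount (periodicHead ++ periodic p tail) ≤ 5 * (16 + (r + p * 6) + 1) / 3 + 2
  seeds≤ = begin
    seedCount (periodicHead ++ periodic p tail)   ≡⟨ ∑-++ periodicHead (periodic p tail) columnSeeds ⟩
    11 + seedCount (periodic p tail)              ≡⟨ cong (11 +_) (seedCount-periodic p tail) ⟩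
    11 + (p * 10 + seedCount tail)                ≡⟨ arith₁ p (seedCount tail) ⟩
    (9 + seedCount tail + 10 * p) + 2             ≤⟨ +-monoˡ-≤ 2 (≤-/3 {9 + seedCount tail + 10 * p} (begin
      3 * (9 + seedCount tail + 10 * p)             ≡⟨ arith₂ p (seedCount tail) ⟩
      3 * (9 + seedCount tail) + 30 * p             ≤⟨ +-monoˡ-≤ (30 * p) few-seeds ⟩
      85 + 5 * r + 30 * p                           ≡⟨ arith₃ r p ⟩
      5 * (16 + (r + p * 6) + 1)                    ∎)) ⟩
    5 * (16 + (r + p * 6) + 1) / 3 + 2            ∎
    where
    open ≤-Reasoning
    arith₁ : ∀ p z → 11 + (p * 10 + z) ≡ (9 + z + 10 * p) + 2
    arith₁ = solve-∀
    arith₂ : ∀ p z → 3 * (9 + z + 10 * p) ≡ 3 * (9 + z) + 30 * p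
    arith₂ = solve-∀
    arith₃ : ∀ r p → 85 + 5 * r + 30 * p ≡ 5 * (16 + (r + p * 6) + 1)
    arith₃ = solve-∀

small-upper-bound : ∀ k → k < 12 → PercolationNumber≤ (grid 4 (4 + k)) 3 (5 * (4 + k + 1) / 3 + 2)
small-upper-bound 0 _ = certified (smallCertificate 0) refl refl (≤ᵇ≡true⇒≤ refl)
small-upper-bound 1 _ = certified (smallCertificate 1) refl refl (≤ᵇ≡true⇒≤ refl)
small-upper-bound 2 _ = certified (smallCertificate 2) refl refl (≤ᵇ≡true⇒≤ refl)
small-upper-bound 3 _ = certified (smallCertificate 3) refl refl (≤ᵇ≡true⇒≤ refl)
small-upper-bound 4 _ = certified (smallCertificate 4) refl refl (≤ᵇ≡true⇒≤ refl)
small-upper-bound 5 _ = certified (smallCertificate 5) refl refl (≤ᵇ≡true⇒≤ refl)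
small-upper-bound 6 _ = certified (smallCertificate 6) refl refl (≤ᵇ≡true⇒≤ refl)
small-upper-bound 7 _ = certified (smallCertificate 7) refl refl (≤ᵇ≡true⇒≤ refl)
small-upper-bound 8 _ = certified (smallCertificate 8) refl refl (≤ᵇ≡true⇒≤ refl)
small-upper-bound 9 _ = certified (smallCertificate 9) refl refl (≤ᵇ≡true⇒≤ refl)
small-upper-bound 10 _ = certified (smallCertificate 10) refl refl (≤ᵇ≡true⇒≤ refl)
small-upper-bound 11 _ = certified (smallCertificate 11) refl refl (≤ᵇ≡true⇒≤ refl)
small-upper-bound (suc (suc (suc (suc (suc (suc (suc (suc (suc (suc (suc (suc k)))))))))))) (s≤s (s≤s (s≤s (s≤s (s≤s (s≤s (s≤s (s≤s (s≤s (s≤s (s≤s (s≤s ()))))))))))))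

large-upper-bound : ∀ x → PercolationNumber≤ (grid 4 (16 + x)) 3 (5 * (16 + x + 1) / 3 + 2)
large-upper-bound x = subst (λ y → PercolationNumber≤ (grid 4 (16 + y)) 3 (5 * (16 + y + 1) / 3 + 2))
  (sym (m≡m%n+[m/n]*n x 6)) (periodic-upper-bound (x % 6) (x / 6) (m%n<n x 6))

upper-bound : ∀ m → 4 ≤ m → PercolationNumber≤ (grid 4 m) 3 (5 * (m + 1) / 3 + 2)
upper-bound m 4≤m =
  subst (λ m → PercolationNumber≤ (grid 4 m) 3 (5 * (m + 1) / 3 + 2)) (m+[n∸m]≡n 4≤m) (bound (m ∸ 4))
  where
  bound : ∀ k → PercolationNumber≤ (grid 4 (4 + k)) 3 (5 * (4 + k + 1) / 3 + 2)
  bound k with k <? 12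
  ... | yes k<12 = small-upper-bound k k<12
  ... | no k≮12 = subst (λ k → PercolationNumber≤ (grid 4 (4 + k)) 3 (5 * (4 + k + 1) / 3 + 2))
                    (m+[n∸m]≡n (≮⇒≥ k≮12)) (large-upper-bound (k ∸ 12))

special-upper-bound : ∀ {m} → m ≡ 5 ⊎ m ≡ 7 ⊎ m ≡ 11 → PercolationNumber≤ (grid 4 m) 3 (5 * (m + 1) / 3 + 1)
special-upper-bound (inj₁ refl) = certified (smallCertificate 1) refl refl (≤ᵇ≡true⇒≤ refl)
special-upper-bound (inj₂ (inj₁ refl)) = certified (smallCertificate 3) refl refl (≤ᵇ≡true⇒≤ refl)
special-upper-bound (inj₂ (inj₂ refl)) = certified (smallCertificate 7) refl refl (≤ᵇ≡true⇒≤ refl)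

theorem3 : (m : ℕ) → 4 ≤ m →
    ∃ λ (k : ℕ) → ∃ λ (Φ : ℕ) →
      IsPercolationNumber (grid 4 m) 3 k
      × k ≡ (5 * (m + 1)) / 3 + Φ
      × (Φ ≡ 1 ⊎ Φ ≡ 2)
      × ((m ≡ 5 ⊎ m ≡ 7 ⊎ m ≡ 11) → Φ ≡ 1)
theorem3 m 4≤m with percolationNumber-dichotomy
  (percolationNumber≤? (grid 4 m) 3 grid-≟ grid-complete (5 * (m + 1) / 3 + 1))
  (lower-bound m (≤-trans (s≤s (s≤s z≤n)) 4≤m))
  (subst (PercolationNumber≤ (grid 4 m) 3) (+-suc (5 * (m + 1) / 3) 1) (upper-bound m 4≤m))
... | inj₁ is-m = _ , 1 , is-m , refl , inj₁ refl , λ _ → refl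
... | inj₂ (is-m , not-smaller) =
  _ , 2 , is-m , sym (+-suc _ 1) , inj₂ refl , λ special → ⊥-elim (not-smaller (special-upper-bound special))
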